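{- Let $\Gamma=(S,R)$ be a finite simple graph, $xy\in R$, and $\widehat\Gamma$ obtained by inserting a new vertex $z$ on $xy$. For all $u\in\{x,y\}$ and $w\in W$, $\kappa(w)\circ\delta_u=\delta_u\circ\widehat\kappa(\rho_u(w))$.
   Context: $\widehat S=S\cup\{z\}$, $\widehat R=(R\setminus\{xy\})\cup\{xz,yz\}$. $V$ (resp. $\widehat V$) is the $\mathbb F_2$-vector space with basis $\{\alpha_s\mid s\in S\}$ (resp. $\{\alpha_s\mid s\in\widehat S\}$); $V^*$, $\widehat V^*$ are the duals with dual bases $\{f_s\}$, $\{h_s\}$. $W$ (resp. $\widehat W$) is the Coxeter group generated by $S$ (resp. $\widehat S$) with relations $s^2=1$, $(st)^2=1$ for non-adjacent $s,t$, $(st)^3=1$ for adjacent $s,t$ in $\Gamma$ (resp. $\widehat\Gamma$). $\kappa:W\to\mathrm{GL}(V^*)$ is the representation with $\kappa(s)f=f+f(\alpha_s)\sum_{t:\,st\in R}f_t$ and $\widehat\kappa:\widehat W\to\mathrm{GL}(\widehat V^*)$ the one with $\widehat\kappa(s)h=h+h(\alpha_s)\sum_{t:\,st\in\widehat R}h_t$. For $u\in\{x,y\}$, $\rho_u:W\to\widehat W$ is the homomorphism with $\rho_u(u)=zuz$ and $\rho_u(s)=s$ for $s\in S\setminus\{u\}$, and $\delta_u:\widehat V^*\to V^*$ is the linear map with $\delta_u(h_z)=f_u$, $\delta_u(h_s)=f_s$ for $s\in S$. -}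

module Defs where

open import Data.Bool using (Bool; true; false; _∧_; _∨_; _xor_; not)
open import Data.Fin using (Fin; zero; suc)
open import Data.Fin.Properties using (_≟_)
open import Data.List using (List; []; _∷_; _++_; concatMap)
open import Data.Nat using (ℕ; suc)
open import Relation.Nullary.Decidable using (⌊_⌋)
open import Relation.Binary.PropositionalEquality using (_≡_)
open import Function using (_∘_; id)

-- Field F₂ is Bool with _xor_ (addition) and _∧_ (multiplication).

record SimpleGraph (n : ℕ) : Set where
  field
    adj   : Fin n → Fin n → Bool
    sym   : ∀ s t → adj s t ≡ adj t s
    irrfl : ∀ s → adj s s ≡ false
open SimpleGraph public

_==_ : ∀ {n} → Fin n → Fin n → Bool
a == b = ⌊ a ≟ b ⌋

-- Subdivision of the edge xy by a new vertex z.
-- Vertex set Ŝ = Fin (suc n): z is `zero`, and s ∈ S is `suc s`.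
-- R̂ = (R ∖ {xy}) ∪ {xz, yz}.
isXY : ∀ {n} → Fin n → Fin n → Fin n → Fin n → Bool
isXY x y s t = (s == x ∧ t == y) ∨ (s == y ∧ t == x)

subdivAdj : ∀ {n} → (Fin n → Fin n → Bool) → Fin n → Fin n →
            Fin (suc n) → Fin (suc n) → Bool
subdivAdj a x y zero    zero    = false
subdivAdj a x y zero    (suc t) = t == x ∨ t == y
subdivAdj a x y (suc s) zero    = s == x ∨ s == y
subdivAdj a x y (suc s) (suc t) = a s t ∧ not (isXY x y s t)

-- Dual space V* = F₂^S: a functional f is given by its coordinates
-- w.r.t. the dual basis {f_s}, i.e. f = Σ_s f(α_s) f_s, so f ↦ (s ↦ f(α_s)).
Dual : ℕ → Set
Dual n = Fin n → Bool

-- κ(s) f = f + f(α_s) Σ_{t : st ∈ R} f_t, for an adjacency function a.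
κgen : ∀ {n} → (Fin n → Fin n → Bool) → Fin n → Dual n → Dual n
κgen a s f t = f t xor (f s ∧ a s t)

-- Elements of the Coxeter group are represented by words in the generators;
-- κ is extended multiplicatively: κ(s₁ ⋯ s_k) = κ(s₁) ∘ ⋯ ∘ κ(s_k).
Word : ℕ → Set
Word n = List (Fin n)

κword : ∀ {n} → (Fin n → Fin n → Bool) → Word n → Dual n → Dual n
κword a []      = id
κword a (s ∷ w) = κgen a s ∘ κword a w

κ : ∀ {n} → SimpleGraph n → Word n → Dual n → Dual n
κ Γ = κword (adj Γ)

κ̂ : ∀ {n} → SimpleGraph n → Fin n → Fin n → Word (suc n) → Dual (suc n) → Dual (suc n)
κ̂ Γ x y = κword (subdivAdj (adj Γ) x y)

ρgen : ∀ {n} → Fin n → Fin n → Word (suc n)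
ρgen u s with s == u
... | true  = zero ∷ suc u ∷ zero ∷ []
... | false = suc s ∷ []

ρ : ∀ {n} → Fin n → Word n → Word (suc n)
ρ u = concatMap (ρgen u)

-- δ_u : V̂* → V*, h_z ↦ f_u, h_s ↦ f_s.
-- In coordinates: (δ_u h)(α_t) = h(α_t) + h(α_z)·[t = u].
δ : ∀ {n} → Fin n → Dual (suc n) → Dual n
δ u h t = h (suc t) xor (h zero ∧ t == u)

-- It suffices to treat a single generator s, by induction on the word.  For
-- s ≠ u the transvections κ(s) and κ̂(s) correspond under δ_u: the edge sv of
-- Γ (v the other endpoint) is replaced in Γ̂ by sz, and δ_u sends h_z to f_u.
-- For s = u the key identity is δ_u ∘ κ̂(z) = δ_v, whence
--   δ_u κ̂(zuz) = δ_v κ̂(u) κ̂(z) = κ(u) δ_v κ̂(z) = κ(u) δ_u,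
-- the middle step being the first case with the roles of u and v exchanged.
module Submission where

open import Defs hiding (sym)
open import Data.Bool using (Bool; true; false; _∧_; _xor_; not)
open import Data.Bool.Properties
  using (xor-∧-commutativeRing; ∧-identityʳ; xor-identityʳ; ∨-identityʳ)
open import Data.Fin using (Fin; zero; suc)
open import Data.Fin.Properties using (_≟_)
open import Data.List using ([]; _∷_; _++_)
open import Data.Maybe using (just; nothing)
open import Data.Nat using (ℕ)
open import Data.Sum using (_⊎_; inj₁; inj₂)
open import Function using (_∘_)
open import Level using (0ℓ)
open import Relation.Nullary using (Dec; yes; no; contradiction)
open import Relation.Binary.PropositionalEquality
open import Tactic.RingSolver using (solve-∀)
open import Tactic.RingSolver.Core.AlmostCommutativeRing
  using (AlmostCommutativeRing; fromCommutativeRing)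

-- Coefficients are normalised in Bool itself, so the solver knows that x xor x = false.
𝔽₂ : AlmostCommutativeRing 0ℓ 0ℓ
𝔽₂ = fromCommutativeRing xor-∧-commutativeRing λ { false → just refl ; true → nothing }

κgen-cong : ∀ {n} (a : Fin n → Fin n → Bool) s {f g : Dual n} →
            (∀ t → f t ≡ g t) → ∀ t → κgen a s f t ≡ κgen a s g t
κgen-cong a s f≗g t = cong₂ (λ ft fs → ft xor (fs ∧ a s t)) (f≗g t) (f≗g s)

κword-++ : ∀ {n} (a : Fin n → Fin n → Bool) (w₁ w₂ : Word n) (f : Dual n) →
           κword a (w₁ ++ w₂) f ≡ κword a w₁ (κword a w₂ f)
κword-++ a []       w₂ f = refl
κword-++ a (s ∷ w₁) w₂ f = cong (κgen a s) (κword-++ a w₁ w₂ f)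

==-refl : ∀ {n} (s : Fin n) → s == s ≡ true
==-refl s with s ≟ s
... | yes _   = refl
... | no s≢s = contradiction refl s≢s

==-false : ∀ {n} {s t : Fin n} → s ≢ t → s == t ≡ false
==-false {s = s} {t} s≢t with s ≟ t
... | yes s≡t = contradiction s≡t s≢t
... | no _    = refl

ρgen-self : ∀ {n} (u : Fin n) → ρgen u u ≡ zero ∷ suc u ∷ zero ∷ []
ρgen-self u rewrite ==-refl u = refl

ρgen-≢ : ∀ {n} {u s : Fin n} → s ≢ u → ρgen u s ≡ suc s ∷ []
ρgen-≢ s≢u rewrite ==-false s≢u = refl

∧-not≡xor : ∀ {a b} → (b ≡ true → a ≡ true) → a ∧ not b ≡ a xor b
∧-not≡xor {a} {false} _   = trans (∧-identityʳ a) (sym (xor-identityʳ a))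
∧-not≡xor {a} {true}  b⇒a rewrite b⇒a refl = refl

δ-κgen-z-identity : ∀ T Z p q →
  (T xor (Z ∧ (p xor q))) xor ((Z xor (Z ∧ false)) ∧ p) ≡ T xor (Z ∧ q)
δ-κgen-z-identity = solve-∀ 𝔽₂

κgen-δ-≢-identity : ∀ T Z B A p q →
  (T xor (Z ∧ q)) xor ((B xor (Z ∧ false)) ∧ A) ≡
  (T xor (B ∧ (A xor (p ∧ q)))) xor ((Z xor (B ∧ p)) ∧ q)
κgen-δ-≢-identity = solve-∀ 𝔽₂

module Subdivision {n} (Γ : SimpleGraph n) {x y : Fin n} (xy : adj Γ x y ≡ true) where

  a : Fin n → Fin n → Bool
  a = adj Γ

  â : Fin (ℕ.suc n) → Fin (ℕ.suc n) → Bool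
  â = subdivAdj a x y

  data Endpoints : Fin n → Fin n → Set where
    xy-end : Endpoints x y
    yx-end : Endpoints y x

  swap : ∀ {u v} → Endpoints u v → Endpoints v u
  swap xy-end = yx-end
  swap yx-end = xy-end

  adj-endpoints : ∀ {u v} → Endpoints u v → a u v ≡ true
  adj-endpoints xy-end = xy
  adj-endpoints yx-end = trans (SimpleGraph.sym Γ y x) xy

  x≢y : x ≢ y
  x≢y refl with trans (sym xy) (irrfl Γ x)
  ... | ()

  endpoints-distinct : ∀ {u v} → Endpoints u v → u ≢ v
  endpoints-distinct xy-end = x≢y
  endpoints-distinct yx-end = x≢y ∘ sym

  subdiv-z-adj : ∀ {u v} → Endpoints u v → ∀ t → â zero (suc t) ≡ (t == u) xor (t == v)
  subdiv-z-adj xy-end t with t ≟ x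
  ... | yes refl rewrite ==-false x≢y = refl
  ... | no _     = refl
  subdiv-z-adj yx-end t with t ≟ x
  ... | yes refl rewrite ==-false x≢y = refl
  ... | no _     = sym (xor-identityʳ (t == y))

  subdiv-adj-z : ∀ {u v s} → Endpoints u v → s ≢ u → â (suc s) zero ≡ s == v
  subdiv-adj-z xy-end s≢x rewrite ==-false s≢x = refl
  subdiv-adj-z yx-end s≢y rewrite ==-false s≢y = ∨-identityʳ _

  isXY-≢ : ∀ {u v s} → Endpoints u v → s ≢ u → ∀ t → isXY x y s t ≡ (s == v ∧ t == u)
  isXY-≢ xy-end s≢x t rewrite ==-false s≢x = refl
  isXY-≢ yx-end s≢y t rewrite ==-false s≢y = ∨-identityʳ _

  subdiv-adj : ∀ {u v s} → Endpoints u v → s ≢ u → ∀ t →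
               â (suc s) (suc t) ≡ a s t xor (s == v ∧ t == u)
  subdiv-adj {u} {v} {s} e s≢u t rewrite isXY-≢ e s≢u t = ∧-not≡xor edge
    where
    edge : (s == v ∧ t == u) ≡ true → a s t ≡ true
    edge with s ≟ v | t ≟ u
    ... | yes refl | yes refl = λ _ → adj-endpoints (swap e)
    ... | yes _    | no _     = λ ()
    ... | no _     | _        = λ ()

  δ-κgen-z : ∀ {u v} → Endpoints u v → ∀ h t → δ u (κgen â zero h) t ≡ δ v h t
  δ-κgen-z {u} {v} e h t rewrite subdiv-z-adj e t =
    δ-κgen-z-identity (h (suc t)) (h zero) (t == u) (t == v)

  κgen-δ-≢ : ∀ {u v s} → Endpoints u v → s ≢ u → ∀ h t →
             κgen a s (δ u h) t ≡ δ u (κgen â (suc s) h) t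
  κgen-δ-≢ {u} {v} {s} e s≢u h t
    rewrite ==-false s≢u | subdiv-adj e s≢u t | subdiv-adj-z e s≢u =
    κgen-δ-≢-identity (h (suc t)) (h zero) (h (suc s)) (a s t) (s == v) (t == u)

  κgen-δ-self : ∀ {u v} → Endpoints u v → ∀ h t →
                κgen a u (δ u h) t ≡ δ u (κgen â zero (κgen â (suc u) (κgen â zero h))) t
  κgen-δ-self {u} {v} e h t = begin
    κgen a u (δ u h) t
      ≡⟨ κgen-cong a u (λ r → sym (δ-κgen-z (swap e) h r)) t ⟩
    κgen a u (δ v (κgen â zero h)) t
      ≡⟨ κgen-δ-≢ (swap e) (endpoints-distinct e) (κgen â zero h) t ⟩
    δ v (κgen â (suc u) (κgen â zero h)) t
      ≡⟨ δ-κgen-z e (κgen â (suc u) (κgen â zero h)) t ⟨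
    δ u (κgen â zero (κgen â (suc u) (κgen â zero h))) t
      ∎
    where open ≡-Reasoning

  -- The decision is an argument because `with s ≟ u` would also abstract the
  -- test s == u occurring in δ u h s.
  κgen-δ-ρgen : ∀ {u v s} → Endpoints u v → Dec (s ≡ u) → ∀ h t →
                κgen a s (δ u h) t ≡ δ u (κword â (ρgen u s) h) t
  κgen-δ-ρgen {u} e (yes refl) h t rewrite ρgen-self u = κgen-δ-self e h t
  κgen-δ-ρgen     e (no s≢u)   h t rewrite ρgen-≢ s≢u = κgen-δ-≢ e s≢u h t

  κword-δ-ρ : ∀ {u v} → Endpoints u v → ∀ w h t →
              κword a w (δ u h) t ≡ δ u (κword â (ρ u w) h) t
  κword-δ-ρ e       []      h t = refl
  κword-δ-ρ {u} e (s ∷ w) h t = begin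
    κgen a s (κword a w (δ u h)) t
      ≡⟨ κgen-cong a s (κword-δ-ρ e w h) t ⟩
    κgen a s (δ u (κword â (ρ u w) h)) t
      ≡⟨ κgen-δ-ρgen e (s ≟ u) (κword â (ρ u w) h) t ⟩
    δ u (κword â (ρgen u s) (κword â (ρ u w) h)) t
      ≡⟨ cong (λ g → δ u g t) (κword-++ â (ρgen u s) (ρ u w) h) ⟨
    δ u (κword â (ρ u (s ∷ w)) h) t
      ∎
    where open ≡-Reasoning

lemma4p3 : (n : ℕ) (Γ : SimpleGraph n) (x y : Fin n) → adj Γ x y ≡ true →
    (u : Fin n) → (u ≡ x ⊎ u ≡ y) → (w : Word n) →
    (h : Dual (ℕ.suc n)) (t : Fin n) →
    κ Γ w (δ u h) t ≡ δ u (κ̂ Γ x y (ρ u w) h) t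
lemma4p3 n Γ x y xy u (inj₁ refl) = κword-δ-ρ xy-end where open Subdivision Γ xy
lemma4p3 n Γ x y xy u (inj₂ refl) = κword-δ-ρ yx-end where open Subdivision Γ xy
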